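{- Let $k\ge 2$ and let $B=(1,b_2,\dots,b_k)$ be positive integers with $1<b_2<\cdots<b_k$, and let $c=\max\{O_B(r)\mid 0\le r\le b_k-1\}$. Then for every positive integer $r$ with $r\ge \left\lceil\frac{(c-1)b_{k-1}}{b_k-b_{k-1}}\right\rceil\cdot b_k$ we have $O_B(b_k+r)=O_B(r)+1$.
   Context: For $M\in\mathbb{N}$, $O_B(M):=\min\{\sum_{i=1}^k x_i \mid \sum_{i=1}^k b_ix_i=M,\ x_i\in\mathbb{N}\}$ with $b_1=1$. $\mathbb{N}$ denotes the nonnegative integers. -}

module Defs where

open import Data.Nat using (ℕ; zero; suc; _+_; _*_; _∸_; _≤_; _<_; NonZero)
open import Data.Nat.DivMod using (_/_)
open import Data.Fin using (Fin; zero; suc; fromℕ; inject₁; toℕ)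
open import Data.Vec using (Vec; lookup; zipWith; sum)
open import Data.Product using (Σ; _×_; _,_)
open import Relation.Binary.PropositionalEquality using (_≡_)

weighted : ∀ {k} → Vec ℕ k → Vec ℕ k → ℕ
weighted b x = sum (zipWith _*_ b x)

Represents : ∀ {k} → Vec ℕ k → ℕ → Vec ℕ k → Set
Represents b M x = weighted b x ≡ M

IsOpt : ∀ {k} → Vec ℕ k → ℕ → ℕ → Set
IsOpt {k} b M m =
  Σ (Vec ℕ k) (λ x → Represents b M x × sum x ≡ m)
  × ((y : Vec ℕ k) → Represents b M y → m ≤ sum y)

ceilDiv : (a d : ℕ) → .{{NonZero d}} → ℕ
ceilDiv a d = (a + (d ∸ 1)) / d

StrictlyIncreasing : ∀ {k} → Vec ℕ k → Set
StrictlyIncreasing {k} b = (i j : Fin k) → toℕ i < toℕ j → lookup b i < lookup b j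

-- Adding a coin b_k to an optimal representation of r gives O(b_k + r) ≤ O(r) + 1.
-- Conversely, if an optimal representation of b_k + r contains a coin b_k, removing it
-- gives O(r) < O(b_k + r). Otherwise all its coins are at most b_{k-1}, so
-- b_k + r ≤ b_{k-1} O(b_k + r). Writing r = q b_k + s with s < b_k gives
-- O(r) ≤ q + O(s) with O(s) ≤ min(c, s), and q ≥ ⌈(c-1) b_{k-1} / (b_k - b_{k-1})⌉ makes
-- b_{k-1} (q + O(s)) < b_k + r, so O(b_k + r) ≤ O(r) is impossible.
module Submission where

open import Defs
open import Data.Nat using (ℕ; zero; suc; _+_; _*_; _∸_; _≤_; _<_; NonZero; >-nonZero; z≤n; s≤s; s≤s⁻¹; z<s; _≟_; _≤?_)
open import Data.Nat.DivMod using (_/_; _%_; m≡m%n+[m/n]*n; m%n<n; m*n/n≡m; /-mono-≤)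
open import Data.Nat.Induction using (<-rec)
open import Data.Nat.Properties
open import Algebra.Properties.CommutativeSemigroup +-commutativeSemigroup using (x∙yz≈y∙xz)
open import Data.Fin using (zero; suc; fromℕ; inject₁; toℕ)
import Data.Fin.Properties as Fin
open import Data.Vec using (Vec; lookup; []; _∷_; sum; replicate; _[_]%=_; _[_]≔_)
open import Data.Vec.Properties using ([]%=-∘; []≔-lookup)
open import Data.Product using (Σ; _×_; _,_)
open import Data.Sum using (_⊎_; inj₁; inj₂)
open import Relation.Nullary using (Dec; yes; no)
open import Relation.Nullary.Decidable using (_×-dec_)
open import Relation.Unary using (Decidable)
open import Relation.Binary.PropositionalEquality
  using (_≡_; refl; sym; trans; cong; cong₂; subst; _≢_; module ≡-Reasoning)

RepresentableWith : ∀ {k} → Vec ℕ k → ℕ → ℕ → Set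
RepresentableWith {k} b M j = Σ (Vec ℕ k) λ y → Represents b M y × sum y ≡ j

-- The first coordinate x is at most j, so it is found by bounded search.
representableWith? : ∀ {k} (b : Vec ℕ k) M j → Dec (RepresentableWith b M j)
representableWith? [] M j with M ≟ 0 | j ≟ 0
... | yes refl | yes refl = yes ([] , refl , refl)
... | no M≢0   | _        = no λ { ([] , rep , _) → M≢0 (sym rep) }
... | _        | no j≢0   = no λ { ([] , _ , total) → j≢0 (sym total) }
representableWith? (b₀ ∷ bs) M j
  with anyUpTo? (λ x → (b₀ * x ≤? M) ×-dec representableWith? bs (M ∸ b₀ * x) (j ∸ x)) (suc j)
... | yes (x , s≤s x≤j , b₀x≤M , ys , rep , total) =
  yes (x ∷ ys , trans (cong (b₀ * x +_) rep) (m+[n∸m]≡n b₀x≤M)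
              , trans (cong (x +_) total) (m+[n∸m]≡n x≤j))
... | no none = no λ { (x ∷ ys , rep , total) →
  none (x , s≤s (subst (x ≤_) total (m≤m+n x (sum ys)))
          , subst (b₀ * x ≤_) rep (m≤m+n (b₀ * x) _) , ys
          , trans (sym (m+n∸m≡n (b₀ * x) _)) (cong (_∸ b₀ * x) rep)
          , trans (sym (m+n∸m≡n x _)) (cong (_∸ x) total)) }

least : ∀ {P : ℕ → Set} → Decidable P → ∀ n → P n → Σ ℕ λ m → P m × (∀ j → P j → m ≤ j)
least {P} P? = <-rec _ step
  where
  step : ∀ n → (∀ {m} → m < n → P m → Σ ℕ λ m → P m × (∀ j → P j → m ≤ j))
       → P n → Σ ℕ λ m → P m × (∀ j → P j → m ≤ j)
  step n rec pn with anyUpTo? P? n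
  ... | yes (m , m<n , pm) = rec m<n pm
  ... | no none = n , pn , λ j pj → ≮⇒≥ λ j<n → none (j , j<n , pj)

IsOpt-exists : ∀ {k} (b : Vec ℕ k) {M} y → Represents b M y → Σ ℕ (IsOpt b M)
IsOpt-exists b {M} y rep with least (representableWith? b M) (sum y) (y , rep , refl)
... | m , opt , minimal = m , opt , λ z rep-z → minimal (sum z) (z , rep-z , refl)

weighted-add : ∀ {k} (b y : Vec ℕ k) i v →
  weighted b (y [ i ]%= (v +_)) ≡ lookup b i * v + weighted b y
weighted-add (b₀ ∷ bs) (y₀ ∷ ys) zero v =
  trans (cong (_+ weighted bs ys) (*-distribˡ-+ b₀ v y₀)) (+-assoc (b₀ * v) (b₀ * y₀) _)
weighted-add (b₀ ∷ bs) (y₀ ∷ ys) (suc i) v =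
  trans (cong (b₀ * y₀ +_) (weighted-add bs ys i v))
        (x∙yz≈y∙xz (b₀ * y₀) (lookup bs i * v) (weighted bs ys))

sum-add : ∀ {k} (y : Vec ℕ k) i v → sum (y [ i ]%= (v +_)) ≡ v + sum y
sum-add (y₀ ∷ ys) zero v = +-assoc v y₀ (sum ys)
sum-add (y₀ ∷ ys) (suc i) v = trans (cong (y₀ +_) (sum-add ys i v)) (x∙yz≈y∙xz y₀ v (sum ys))

weighted-zeros : ∀ {k} (b : Vec ℕ k) → weighted b (replicate k 0) ≡ 0
weighted-zeros [] = refl
weighted-zeros (b₀ ∷ bs) =
  trans (cong (_+ weighted bs (replicate _ 0)) (*-zeroʳ b₀)) (weighted-zeros bs)

sum-zeros : ∀ k → sum (replicate k 0) ≡ 0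
sum-zeros zero = refl
sum-zeros (suc k) = sum-zeros k

[]≔-pred-[]%=-suc : ∀ {k} (y : Vec ℕ k) i {t} → lookup y i ≡ suc t →
  (y [ i ]≔ t) [ i ]%= suc ≡ y
[]≔-pred-[]%=-suc y i y-i =
  trans ([]%=-∘ y i) (trans (cong (y [ i ]≔_) (sym y-i)) ([]≔-lookup y i))

weighted≤*sum : ∀ {k} (b y : Vec ℕ k) L → (∀ i → lookup y i ≡ 0 ⊎ lookup b i ≤ L) →
  weighted b y ≤ L * sum y
weighted≤*sum [] [] L _ = z≤n
weighted≤*sum (b₀ ∷ bs) (y₀ ∷ ys) L small =
  subst (weighted (b₀ ∷ bs) (y₀ ∷ ys) ≤_) (sym (*-distribˡ-+ L y₀ (sum ys)))
    (+-mono-≤ head (weighted≤*sum bs ys L (λ i → small (suc i))))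
  where
  head : b₀ * y₀ ≤ L * y₀
  head with small zero
  ... | inj₁ refl = subst (_≤ L * 0) (sym (*-zeroʳ b₀)) z≤n
  ... | inj₂ b₀≤L = *-monoˡ-≤ y₀ b₀≤L

IsOpt-add-coins : ∀ {k} (b : Vec ℕ k) i v {M N m o} →
  IsOpt b M m → N ≡ lookup b i * v + M → IsOpt b N o → o ≤ v + m
IsOpt-add-coins b i v ((x , x-rep , x-sum) , _) N≡ (_ , minimal) =
  subst (_ ≤_) (trans (sum-add x i v) (cong (v +_) x-sum))
    (minimal (x [ i ]%= (v +_))
      (trans (weighted-add b x i v) (trans (cong (_ +_) x-rep) (sym N≡))))

IsOpt-remove-coin : ∀ {k} (b : Vec ℕ k) i {M o} y {t} →
  IsOpt b M o → Represents b (lookup b i + M) y → lookup y i ≡ suc t → suc o ≤ sum y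
IsOpt-remove-coin b i {M} {o} y {t} (_ , minimal) y-rep y-i = begin
  suc o                      ≤⟨ s≤s (minimal z z-rep) ⟩
  suc (sum z)                ≡⟨ sym (sum-add z i 1) ⟩
  sum (z [ i ]%= suc)        ≡⟨ cong sum ([]≔-pred-[]%=-suc y i y-i) ⟩
  sum y                      ∎
  where
  open ≤-Reasoning
  z = y [ i ]≔ t
  z-rep : weighted b z ≡ M
  z-rep = +-cancelˡ-≡ (lookup b i) _ _ (begin-equality
    lookup b i + weighted b z      ≡⟨ cong (_+ weighted b z) (sym (*-identityʳ (lookup b i))) ⟩
    lookup b i * 1 + weighted b z  ≡⟨ sym (weighted-add b z i 1) ⟩
    weighted b (z [ i ]%= suc)     ≡⟨ cong (weighted b) ([]≔-pred-[]%=-suc y i y-i) ⟩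
    weighted b y                   ≡⟨ y-rep ⟩
    lookup b i + M                 ∎)

unit-representation : ∀ {k} (b : Vec ℕ (suc k)) → lookup b zero ≡ 1 → ∀ s →
  RepresentableWith b s s
unit-representation {k} b b₀≡1 s =
  replicate (suc k) 0 [ zero ]%= (s +_) ,
  trans (weighted-add b (replicate (suc k) 0) zero s)
    (trans (cong₂ _+_ (trans (cong (_* s) b₀≡1) (*-identityˡ s)) (weighted-zeros b))
           (+-identityʳ s)) ,
  trans (sum-add (replicate (suc k) 0) zero s)
    (trans (cong (s +_) (sum-zeros (suc k))) (+-identityʳ s))

IsOpt-exists-≤ : ∀ {k} (b : Vec ℕ (suc k)) → lookup b zero ≡ 1 → ∀ s →
  Σ ℕ λ m → IsOpt b s m × m ≤ s
IsOpt-exists-≤ b b₀≡1 s with unit-representation b b₀≡1 s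
... | ones , rep , total with IsOpt-exists b ones rep
...   | m , opt@(_ , minimal) = m , opt , subst (m ≤_) total (minimal ones rep)

StrictlyIncreasing⇒monotone : ∀ {k} (b : Vec ℕ k) → StrictlyIncreasing b →
  ∀ i j → toℕ i ≤ toℕ j → lookup b i ≤ lookup b j
StrictlyIncreasing⇒monotone b increasing i j i≤j with m≤n⇒m<n∨m≡n i≤j
... | inj₁ i<j = <⇒≤ (increasing i j i<j)
... | inj₂ i≡j = ≤-reflexive (cong (lookup b) (Fin.toℕ-injective i≡j))

lookup≤penultimate : ∀ {n} (b : Vec ℕ (suc (suc n))) → StrictlyIncreasing b →
  ∀ i → i ≢ fromℕ (suc n) → lookup b i ≤ lookup b (inject₁ (fromℕ n))
lookup≤penultimate {n} b increasing i i≢last =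
  StrictlyIncreasing⇒monotone b increasing i (inject₁ (fromℕ n))
    (subst (toℕ i ≤_) (sym (trans (Fin.toℕ-inject₁ (fromℕ n)) (Fin.toℕ-fromℕ n)))
      (s≤s⁻¹ (subst (toℕ i <_) (Fin.toℕ-fromℕ (suc n)) (Fin.≤∧≢⇒< (Fin.≤fromℕ i) i≢last))))

weighted≤penultimate*sum : ∀ {n} (b y : Vec ℕ (suc (suc n))) → StrictlyIncreasing b →
  lookup y (fromℕ (suc n)) ≡ 0 → weighted b y ≤ lookup b (inject₁ (fromℕ n)) * sum y
weighted≤penultimate*sum {n} b y increasing y-last = weighted≤*sum b y _ small
  where
  small : ∀ i → lookup y i ≡ 0 ⊎ lookup b i ≤ lookup b (inject₁ (fromℕ n))
  small i with i Fin.≟ fromℕ (suc n)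
  ... | yes refl = inj₁ y-last
  ... | no i≢last = inj₂ (lookup≤penultimate b increasing i i≢last)

≤-ceilDiv* : ∀ a d .{{_ : NonZero d}} → a ≤ ceilDiv a d * d
≤-ceilDiv* a d@(suc d-1) = +-cancelʳ-≤ d-1 a (ceilDiv a d * d) (begin
  a + d-1                                ≡⟨ m≡m%n+[m/n]*n (a + d-1) d ⟩
  (a + d-1) % d + ceilDiv a d * d        ≤⟨ +-monoˡ-≤ _ (s≤s⁻¹ (m%n<n (a + d-1) d)) ⟩
  d-1 + ceilDiv a d * d                  ≡⟨ +-comm d-1 _ ⟩
  ceilDiv a d * d + d-1                  ∎)
  where open ≤-Reasoning

ceilDiv*≤⇒≤/* : ∀ a d r K .{{_ : NonZero d}} .{{_ : NonZero K}} →
  ceilDiv a d * K ≤ r → a ≤ r / K * d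
ceilDiv*≤⇒≤/* a d r K C*K≤r = ≤-trans (≤-ceilDiv* a d)
  (*-monoˡ-≤ d (subst (_≤ r / K) (m*n/n≡m (ceilDiv a d) K) (/-mono-≤ C*K≤r ≤-refl)))

small-coins-fall-short : ∀ {K L q s m c} → 0 < K → L ≤ K → m ≤ s → m ≤ c →
  (c ∸ 1) * L ≤ q * (K ∸ L) → L * (q + m) < K + (s + q * K)
small-coins-fall-short {K} {L} {q} {s} {zero} 0<K L≤K _ _ _ = begin-strict
  L * (q + 0)      ≡⟨ cong (L *_) (+-identityʳ q) ⟩
  L * q            ≤⟨ *-monoˡ-≤ q L≤K ⟩
  K * q            ≡⟨ *-comm K q ⟩
  q * K            ≤⟨ m≤n+m (q * K) s ⟩
  s + q * K        <⟨ m<n+m (s + q * K) 0<K ⟩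
  K + (s + q * K)  ∎
  where open ≤-Reasoning
small-coins-fall-short {K} {L} {q} {suc s} {suc m} {suc c} _ L≤K _ (s≤s m≤c) saving = begin-strict
  L * (q + suc m)            ≡⟨ cong (L *_) (+-suc q m) ⟩
  L * suc (q + m)            ≡⟨ *-suc L (q + m) ⟩
  L + L * (q + m)            ≡⟨ cong (L +_) (*-distribˡ-+ L q m) ⟩
  L + (L * q + L * m)        ≤⟨ +-monoʳ-≤ L (+-monoʳ-≤ (L * q) (*-monoʳ-≤ L m≤c)) ⟩
  L + (L * q + L * c)        ≡⟨ cong (λ x → L + (L * q + x)) (*-comm L c) ⟩
  L + (L * q + c * L)        ≤⟨ +-monoʳ-≤ L (+-monoʳ-≤ (L * q) saving) ⟩
  L + (L * q + q * (K ∸ L))  ≡⟨ cong (L +_) split ⟩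
  L + q * K                  <⟨ +-mono-≤-< L≤K (m<n+m (q * K) z<s) ⟩
  K + (suc s + q * K)        ∎
  where
  open ≤-Reasoning
  split : L * q + q * (K ∸ L) ≡ q * K
  split = trans (cong (_+ q * (K ∸ L)) (*-comm L q))
            (trans (sym (*-distribˡ-+ q L (K ∸ L))) (cong (q *_) (m+[n∸m]≡n L≤K)))

lemma2p5 : (n : ℕ) (b : Vec ℕ (suc (suc n)))
    → lookup b zero ≡ 1
    → StrictlyIncreasing b
    → (hk : lookup b (inject₁ (fromℕ n)) < lookup b (fromℕ (suc n)))
    → (c : ℕ)
    → Σ ℕ (λ r₀ → r₀ < lookup b (fromℕ (suc n)) × IsOpt b r₀ c)
    → ((r m : ℕ) → r < lookup b (fromℕ (suc n)) → IsOpt b r m → m ≤ c)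
    → (r : ℕ) → 1 ≤ r
    → ceilDiv ((c ∸ 1) * lookup b (inject₁ (fromℕ n)))
              (lookup b (fromℕ (suc n)) ∸ lookup b (inject₁ (fromℕ n)))
              {{>-nonZero (m<n⇒0<n∸m hk)}}
        * lookup b (fromℕ (suc n)) ≤ r
    → (o o′ : ℕ) → IsOpt b r o → IsOpt b (lookup b (fromℕ (suc n)) + r) o′
    → o′ ≡ o + 1
-- Only the bound c on O(r') for r' < b_k is used: neither that it is attained nor r ≥ 1.
lemma2p5 n b b₀≡1 increasing hk c _ c-max r _ C*K≤r o o′ opt-r opt-K+r@((y , y-rep , y-sum) , _) =
  trans (≤-antisym upper lower) (+-comm 1 o)
  where
  K L : ℕ
  K = lookup b (fromℕ (suc n))
  L = lookup b (inject₁ (fromℕ n))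
  instance
    K-nonZero : NonZero K
    K-nonZero = >-nonZero (≤-<-trans z≤n hk)
    K∸L-nonZero : NonZero (K ∸ L)
    K∸L-nonZero = >-nonZero (m<n⇒0<n∸m hk)

  r≡K*q+s : r ≡ K * (r / K) + r % K
  r≡K*q+s = trans (m≡m%n+[m/n]*n r K)
              (trans (+-comm (r % K) _) (cong (_+ r % K) (*-comm (r / K) K)))

  upper : o′ ≤ suc o
  upper = IsOpt-add-coins b (fromℕ (suc n)) 1 opt-r (cong (_+ r) (sym (*-identityʳ K))) opt-K+r

  lower : suc o ≤ o′
  lower with lookup y (fromℕ (suc n)) in y-last | IsOpt-exists-≤ b b₀≡1 (r % K)
  ... | suc _ | _ = subst (suc o ≤_) y-sum (IsOpt-remove-coin b _ y opt-r y-rep y-last)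
  ... | zero | m , opt-s , m≤s = ≮⇒≥ λ o′<1+o → <-irrefl refl (begin-strict
    K + r                        ≡⟨ sym y-rep ⟩
    weighted b y                 ≤⟨ weighted≤penultimate*sum b y increasing y-last ⟩
    L * sum y                    ≡⟨ cong (L *_) y-sum ⟩
    L * o′                       ≤⟨ *-monoʳ-≤ L (s≤s⁻¹ o′<1+o) ⟩
    L * o                        ≤⟨ *-monoʳ-≤ L (IsOpt-add-coins b _ (r / K) opt-s r≡K*q+s opt-r) ⟩
    L * (r / K + m)              <⟨ small-coins-fall-short (≤-<-trans z≤n hk) (<⇒≤ hk) m≤s
                                      (c-max (r % K) m (m%n<n r K) opt-s)
                                      (ceilDiv*≤⇒≤/* _ (K ∸ L) r K C*K≤r) ⟩
    K + (r % K + r / K * K)      ≡⟨ cong (K +_) (sym (m≡m%n+[m/n]*n r K)) ⟩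
    K + r                        ∎)
    where open ≤-Reasoning
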